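{- For every neighborhood model $M$, every world $w$ of $M$ and every formula $\sigma\in\mathcal L_{\mathsf{INL}}$: $M,w\models_{\mathsf{INL}}\sigma$ if and only if $M,w\models\sigma^*$.
   Context: Fix a set $\mathcal P$ of atoms. A neighborhood model is $M=\langle W,\Sigma,V\rangle$ with $W$ nonempty, $\Sigma(w)$ an arbitrary set of subsets of $W$ (the empty set allowed), $V:W\times\mathcal P\to\{0,1\}$. The language $\mathcal L_{\Rrightarrow\odot}$: $\varphi ::= p \mid \bot \mid \odot \mid (\varphi\wedge\varphi)\mid(\varphi\to\varphi)\mid(\varphi\veebar\varphi)\mid(\varphi\Rrightarrow\varphi)$, with $\veebar$ inquisitive disjunction; $\neg\varphi:=\varphi\to\bot$, $\varphi\vee\psi:=\neg(\neg\varphi\wedge\neg\psi)$, $\Diamond^+\varphi:=\neg(\varphi\Rrightarrow\bot)$, $\Diamond_\odot\varphi:=\Diamond^+\varphi\vee\odot$. Support at $s\subseteq W$: $M,s\models p$ iff $V(w,p)=1$ for all $w\in s$; $M,s\models\bot$ iff $s=\emptyset$; $M,s\models\odot$ iff $\emptyset\in\Sigma(w)$ for all $w\in s$; $\wedge$ conjunctively; $M,s\models\varphi\veebar\psi$ iff $M,s\models\varphi$ or $M,s\models\psi$; $M,s\models\varphi\to\psi$ iff for all $t\subseteq s$, $M,t\models\varphi$ implies $M,t\models\psi$; $M,s\models\varphi\Rrightarrow\psi$ iff for all $w\in s$, $t\in\Sigma(w)$, $M,t\models\varphi$ implies $M,t\models\psi$. Truth: $M,w\models\varphi$ iff $M,\{w\}\models\varphi$.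 Instantial neighborhood logic: $\mathcal L_{\mathsf{INL}}$ has $\sigma ::= p\mid\neg\sigma\mid(\sigma\wedge\sigma)\mid\Box(\rho_1,\dots,\rho_n;\sigma)$ ($n\ge0$), with classical clauses for $\neg,\wedge$ and $M,w\models_{\mathsf{INL}}\Box(\rho_1,\dots,\rho_n;\sigma)$ iff there is $s\in\Sigma(w)$ with $M,v\models_{\mathsf{INL}}\sigma$ for all $v\in s$ and, for each $i\le n$, some $v\in s$ with $M,v\models_{\mathsf{INL}}\rho_i$. Translation $(\cdot)^*:\mathcal L_{\mathsf{INL}}\to\mathcal L_{\Rrightarrow\odot}$: $p^*=p$; $(\neg\sigma)^*=\neg\sigma^*$; $(\rho\wedge\sigma)^*=\rho^*\wedge\sigma^*$; $\Box(;\sigma)^*=\Diamond_\odot\sigma^*$; for $n\ge1$, $\Box(\rho_1,\dots,\rho_n;\sigma)^*=\neg(\sigma^*\Rrightarrow(\neg\rho_1^*\veebar\dots\veebar\neg\rho_n^*))$. -}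

module Defs where

open import Level using (Level; 0ℓ) renaming (suc to lsuc)
open import Data.Bool using (Bool; true)
open import Data.Empty using (⊥)
open import Data.Unit using (⊤)
open import Data.Product using (Σ; _×_; ∃)
open import Data.Sum using (_⊎_)
open import Data.List using (List; []; _∷_)
open import Relation.Nullary using (¬_)
open import Relation.Binary.PropositionalEquality using (_≡_)

Subset : Set → Set₁
Subset W = W → Set

_⊆_ : {W : Set} → Subset W → Subset W → Set
s ⊆ t = ∀ v → s v → t v

IsEmpty : {W : Set} → Subset W → Set
IsEmpty s = ∀ v → ¬ s v

singleton : {W : Set} → W → Subset W
singleton w = λ v → v ≡ w

record NbhdModel (Atom : Set) : Set₂ where
  field
    W     : Set
    inhab : W
    N     : W → Subset W → Set      -- Σ(w) : t ∈ Σ(w) iff N w t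
    V     : W → Atom → Bool

infixr 6 _∧'_
infixr 5 _⊻_
infixr 4 _⇒_ _⇛_

data Form (Atom : Set) : Set where
  atom : Atom → Form Atom
  ⊥'   : Form Atom
  ⊙    : Form Atom
  _∧'_ : Form Atom → Form Atom → Form Atom
  _⇒_  : Form Atom → Form Atom → Form Atom
  _⊻_  : Form Atom → Form Atom → Form Atom
  _⇛_  : Form Atom → Form Atom → Form Atom

module _ {Atom : Set} where

  ¬'_ : Form Atom → Form Atom
  ¬' φ = φ ⇒ ⊥'

  _∨'_ : Form Atom → Form Atom → Form Atom
  φ ∨' ψ = ¬' (¬' φ ∧' ¬' ψ)

  ◇⁺ : Form Atom → Form Atom
  ◇⁺ φ = ¬' (φ ⇛ ⊥')

  ◇⊙ : Form Atom → Form Atom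
  ◇⊙ φ = ◇⁺ φ ∨' ⊙

  module _ (M : NbhdModel Atom) where
    open NbhdModel M

    _⊨_ : Subset W → Form Atom → Set₁
    s ⊨ atom p = Level.Lift _ (∀ w → s w → V w p ≡ true)
    s ⊨ ⊥'     = Level.Lift _ (IsEmpty s)
    -- ∅ ∈ Σ(w): some member of Σ(w) is (extensionally) the empty set
    s ⊨ ⊙      = ∀ w → s w → Σ (Subset W) λ t → N w t × IsEmpty t
    s ⊨ (φ ∧' ψ) = (s ⊨ φ) × (s ⊨ ψ)
    s ⊨ (φ ⇒ ψ)  = ∀ (t : Subset W) → t ⊆ s → t ⊨ φ → t ⊨ ψ
    s ⊨ (φ ⊻ ψ)  = (s ⊨ φ) ⊎ (s ⊨ ψ)
    s ⊨ (φ ⇛ ψ)  = ∀ w → s w → ∀ (t : Subset W) → N w t → t ⊨ φ → t ⊨ ψ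

    _⊨w_ : W → Form Atom → Set₁
    w ⊨w φ = singleton w ⊨ φ

data INL (Atom : Set) : Set where
  atom : Atom → INL Atom
  ¬ᵢ_  : INL Atom → INL Atom
  _∧ᵢ_ : INL Atom → INL Atom → INL Atom
  □    : List (INL Atom) → INL Atom → INL Atom

module _ {Atom : Set} (M : NbhdModel Atom) where
  open NbhdModel M

  _⊨ᵢ_ : W → INL Atom → Set₁
  witnesses : Subset W → List (INL Atom) → Set₁
  w ⊨ᵢ atom p    = Level.Lift _ (V w p ≡ true)
  w ⊨ᵢ (¬ᵢ σ)    = ¬ (w ⊨ᵢ σ)
  w ⊨ᵢ (ρ ∧ᵢ σ)  = (w ⊨ᵢ ρ) × (w ⊨ᵢ σ)
  w ⊨ᵢ □ ρs σ    = Σ (Subset W) λ s → Level.Lift (lsuc 0ℓ) (N w s)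
                     × (∀ v → s v → v ⊨ᵢ σ) × witnesses s ρs
  witnesses s []       = Level.Lift _ ⊤
  witnesses s (ρ ∷ ρs) = (Σ _ λ v → Level.Lift (lsuc 0ℓ) (s v) × (v ⊨ᵢ ρ)) × witnesses s ρs

module _ {Atom : Set} where
  infix 10 _*
  _* : INL Atom → Form Atom
  -- ¬ρ₁* ⊻ … ⊻ ¬ρₙ*  (right-nested), for a nonempty list ρ ∷ ρs
  disjNeg : INL Atom → List (INL Atom) → Form Atom
  atom p * = atom p
  (¬ᵢ σ) * = ¬' (σ *)
  (ρ ∧ᵢ σ) * = ρ * ∧' σ *
  □ [] σ * = ◇⊙ (σ *)
  □ (ρ ∷ ρs) σ * = ¬' (σ * ⇛ disjNeg ρ ρs)
  disjNeg ρ [] = ¬' (ρ *)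
  disjNeg ρ (ρ' ∷ ρs) = ¬' (ρ *) ⊻ disjNeg ρ' ρs

{-# OPTIONS --safe #-}
module Submission where

-- Every translation σ * is flat: a state supports it iff each of its worlds makes it true,
-- since σ * is built from atoms by ∧' and ¬', and ¬' φ is flat for every φ. So "σ holds
-- throughout the neighbourhood t" is the same as "t supports σ *", and both □ clauses become
-- support conditions at neighbourhoods: t fails to support ¬' ρ₁ * ⊻ … ⊻ ¬' ρₙ * exactly when
-- every ρᵢ has an instance in t, and ◇⊙ φ says that some neighbourhood, empty or not, supports φ.
-- Excluded middle turns the double negations that the translation produces into witnesses.

open import Defs
open import Level using (0ℓ; Lift; lift; lower) renaming (suc to lsuc)
open import Axiom.ExcludedMiddle using (ExcludedMiddle)
open import Axiom.DoubleNegationElimination using (em⇒dne)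
open import Function.Base using (_∘_)
open import Function.Bundles using (_⇔_; mk⇔; module Equivalence)
open import Function.Construct.Symmetry using (⇔-sym)
open import Function.Related.Propositional using (module EquationalReasoning)
open import Function.Related.TypeIsomorphisms using (¬-cong-⇔)
open import Data.Product using (Σ; _×_; _,_; proj₁; proj₂)
open import Data.Product.Function.NonDependent.Propositional using (_×-⇔_)
open import Data.Sum using (inj₁; inj₂)
open import Data.Empty using (⊥-elim)
open import Data.List using ([]; _∷_)
open import Relation.Nullary using (¬_)
open import Relation.Nullary.Negation using (_¬-⊎_)
open import Relation.Binary.PropositionalEquality using (refl)

open Equivalence using (to; from)

module SupportSemantics {Atom : Set} (M : NbhdModel Atom) where
  open NbhdModel M

  infix 5 _⊩_ _⊩w_

  _⊩_ : Subset W → Form Atom → Set₁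
  _⊩_ = _⊨_ M

  _⊩w_ : W → Form Atom → Set₁
  _⊩w_ = _⊨w_ M

  ⊩-persistent : ∀ φ {s t : Subset W} → t ⊆ s → s ⊩ φ → t ⊩ φ
  ⊩-persistent (atom p) t⊆s (lift f) = lift λ v tv → f v (t⊆s v tv)
  ⊩-persistent ⊥'       t⊆s (lift e) = lift λ v tv → e v (t⊆s v tv)
  ⊩-persistent ⊙        t⊆s f        = λ v tv → f v (t⊆s v tv)
  ⊩-persistent (φ ∧' ψ) t⊆s (sφ , sψ) = ⊩-persistent φ t⊆s sφ , ⊩-persistent ψ t⊆s sψ
  ⊩-persistent (φ ⇒ ψ)  t⊆s f        = λ u u⊆t → f u (λ v uv → t⊆s v (u⊆t v uv))
  ⊩-persistent (φ ⊻ ψ)  t⊆s (inj₁ sφ) = inj₁ (⊩-persistent φ t⊆s sφ)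
  ⊩-persistent (φ ⊻ ψ)  t⊆s (inj₂ sψ) = inj₂ (⊩-persistent ψ t⊆s sψ)
  ⊩-persistent (φ ⇛ ψ)  t⊆s f        = λ v tv → f v (t⊆s v tv)

  ⊩-empty : ∀ φ {s : Subset W} → IsEmpty s → s ⊩ φ
  ⊩-empty (atom p) e = lift λ v sv → ⊥-elim (e v sv)
  ⊩-empty ⊥'       e = lift e
  ⊩-empty ⊙        e = λ v sv → ⊥-elim (e v sv)
  ⊩-empty (φ ∧' ψ) e = ⊩-empty φ e , ⊩-empty ψ e
  ⊩-empty (φ ⇒ ψ)  e = λ t t⊆s _ → ⊩-empty ψ λ v tv → e v (t⊆s v tv)
  ⊩-empty (φ ⊻ ψ)  e = inj₁ (⊩-empty φ e)
  ⊩-empty (φ ⇛ ψ)  e = λ v sv → ⊥-elim (e v sv)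

  singleton⊆ : {s : Subset W} {v : W} → s v → singleton v ⊆ s
  singleton⊆ sv _ refl = sv

  ⊩¬'⇔ : ∀ φ {s : Subset W} → s ⊩ ¬' φ ⇔ (∀ v → s v → ¬ v ⊩w φ)
  ⊩¬'⇔ φ = mk⇔
    (λ s¬φ v sv vφ → lower (s¬φ (singleton v) (singleton⊆ sv) vφ) v refl)
    (λ f t t⊆s tφ → lift λ v tv → f v (t⊆s v tv) (⊩-persistent φ (singleton⊆ tv) tφ))

  ⊩w¬'⇔ : ∀ φ {w : W} → w ⊩w ¬' φ ⇔ (¬ w ⊩w φ)
  ⊩w¬'⇔ φ = mk⇔ (λ w¬φ → to (⊩¬'⇔ φ) w¬φ _ refl) (λ ¬wφ → from (⊩¬'⇔ φ) λ { _ refl → ¬wφ })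

  ⊩w⇛⇔ : ∀ φ ψ {w : W} → w ⊩w (φ ⇛ ψ) ⇔ (∀ t → N w t → t ⊩ φ → t ⊩ ψ)
  ⊩w⇛⇔ φ ψ = mk⇔ (λ h → h _ refl) (λ { h _ refl → h })

  ⊩w⊙⇔ : {w : W} → w ⊩w ⊙ ⇔ Σ (Subset W) (λ t → N w t × IsEmpty t)
  ⊩w⊙⇔ = mk⇔ (λ h → h _ refl) (λ { h _ refl → h })

  Flat : Form Atom → Set₁
  Flat φ = ∀ {s} → (∀ v → s v → v ⊩w φ) → s ⊩ φ

  flat-⊩⇔ : ∀ {φ} → Flat φ → ∀ {s} → s ⊩ φ ⇔ (∀ v → s v → v ⊩w φ)
  flat-⊩⇔ {φ} flat = mk⇔ (λ sφ v sv → ⊩-persistent φ (singleton⊆ sv) sφ) flat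

  atom-flat : ∀ p → Flat (atom p)
  atom-flat p f = lift λ v sv → lower (f v sv) v refl

  ∧'-flat : ∀ {φ ψ} → Flat φ → Flat ψ → Flat (φ ∧' ψ)
  ∧'-flat φ-flat ψ-flat f = φ-flat (λ v → proj₁ ∘ f v) , ψ-flat (λ v → proj₂ ∘ f v)

  ¬'-flat : ∀ φ → Flat (¬' φ)
  ¬'-flat φ f = from (⊩¬'⇔ φ) λ v sv → to (⊩w¬'⇔ φ) (f v sv)

  *-flat : ∀ σ → Flat (σ *)
  *-flat (atom p)       = atom-flat p
  *-flat (¬ᵢ σ)         = ¬'-flat (σ *)
  *-flat (ρ ∧ᵢ σ)       = ∧'-flat (*-flat ρ) (*-flat σ)
  *-flat (□ [] σ)       = ¬'-flat (¬' (◇⁺ (σ *)) ∧' ¬' ⊙)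
  *-flat (□ (ρ ∷ ρs) σ) = ¬'-flat (σ * ⇛ disjNeg ρ ρs)

module TranslationCorrectness (em : ExcludedMiddle (lsuc 0ℓ)) {Atom : Set} (M : NbhdModel Atom) where
  open NbhdModel M
  open SupportSemantics M
  open EquationalReasoning

  infix 5 _⊩ᵢ_

  _⊩ᵢ_ : W → INL Atom → Set₁
  _⊩ᵢ_ = _⊨ᵢ_ M

  dne : {P : Set₁} → ¬ ¬ P → P
  dne = em⇒dne em

  -- A nonempty supporting neighbourhood witnesses ◇⁺φ, an empty one witnesses ⊙.
  ⊩w◇⊙⇔ : ∀ φ {w : W} → w ⊩w ◇⊙ φ ⇔ Σ (Subset W) (λ t → N w t × t ⊩ φ)
  ⊩w◇⊙⇔ φ = mk⇔ supported ◇⊙-from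
    where
    supported : ∀ {w} → w ⊩w ◇⊙ φ → Σ (Subset W) (λ t → N w t × t ⊩ φ)
    supported w◇⊙φ = dne λ none → to (⊩w¬'⇔ (¬' (◇⁺ φ) ∧' ¬' ⊙)) w◇⊙φ
      ( from (⊩w¬'⇔ (◇⁺ φ)) (λ w◇⁺φ → to (⊩w¬'⇔ (φ ⇛ ⊥')) w◇⁺φ
          (from (⊩w⇛⇔ φ ⊥') λ t Nt tφ → ⊥-elim (none (t , Nt , tφ))))
      , from (⊩w¬'⇔ ⊙) (λ w⊙ → let (t , Nt , t-empty) = to ⊩w⊙⇔ w⊙ in
          none (t , Nt , ⊩-empty φ t-empty)) )
    ◇⊙-from : ∀ {w} → Σ (Subset W) (λ t → N w t × t ⊩ φ) → w ⊩w ◇⊙ φ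
    ◇⊙-from (t , Nt , tφ) = from (⊩w¬'⇔ (¬' (◇⁺ φ) ∧' ¬' ⊙)) λ (w¬◇⁺φ , w¬⊙) →
      to (⊩w¬'⇔ (◇⁺ φ)) w¬◇⁺φ (from (⊩w¬'⇔ (φ ⇛ ⊥')) λ w□¬φ →
        to (⊩w¬'⇔ ⊙) w¬⊙ (from ⊩w⊙⇔ (t , Nt , lower (to (⊩w⇛⇔ φ ⊥') w□¬φ t Nt tφ))))

  ⊩w¬⇛⇔ : ∀ φ ψ {w : W} → w ⊩w ¬' (φ ⇛ ψ) ⇔ Σ (Subset W) (λ t → N w t × t ⊩ φ × ¬ t ⊩ ψ)
  ⊩w¬⇛⇔ φ ψ = mk⇔
    (λ w¬⇛ → dne λ none → to (⊩w¬'⇔ (φ ⇛ ψ)) w¬⇛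
      (from (⊩w⇛⇔ φ ψ) λ t Nt tφ → dne λ ¬tψ → none (t , Nt , tφ , ¬tψ)))
    (λ (t , Nt , tφ , ¬tψ) → from (⊩w¬'⇔ (φ ⇛ ψ)) λ w⇛ → ¬tψ (to (⊩w⇛⇔ φ ψ) w⇛ t Nt tφ))

  mutual
    ⊩ᵢ⇔* : ∀ σ {w : W} → w ⊩ᵢ σ ⇔ w ⊩w σ *
    ⊩ᵢ⇔* (atom p) = mk⇔ (λ (lift e) → lift λ { _ refl → e }) (λ (lift f) → lift (f _ refl))
    ⊩ᵢ⇔* (¬ᵢ σ) {w} = begin
      (¬ w ⊩ᵢ σ)     ∼⟨ ¬-cong-⇔ (⊩ᵢ⇔* σ) ⟩
      (¬ w ⊩w σ *)   ∼⟨ ⇔-sym (⊩w¬'⇔ (σ *)) ⟩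
      w ⊩w ¬' (σ *)  ∎
    ⊩ᵢ⇔* (ρ ∧ᵢ σ) = ⊩ᵢ⇔* ρ ×-⇔ ⊩ᵢ⇔* σ
    ⊩ᵢ⇔* (□ [] σ) {w} = begin
      w ⊩ᵢ □ [] σ                                ∼⟨ mk⇔
        (λ (t , lift Nt , tσ , _) → t , Nt , to (all⇔* σ) tσ)
        (λ (t , Nt , tσ) → t , lift Nt , from (all⇔* σ) tσ , _) ⟩
      Σ (Subset W) (λ t → N w t × t ⊩ σ *)       ∼⟨ ⇔-sym (⊩w◇⊙⇔ (σ *)) ⟩
      w ⊩w ◇⊙ (σ *)                              ∎
    ⊩ᵢ⇔* (□ (ρ ∷ ρs) σ) {w} = begin
      w ⊩ᵢ □ (ρ ∷ ρs) σ                          ∼⟨ mk⇔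
        (λ (t , lift Nt , tσ , ws) → t , Nt , to (all⇔* σ) tσ , to (witnesses⇔ ρ ρs) ws)
        (λ (t , Nt , tσ , ¬tD) → t , lift Nt , from (all⇔* σ) tσ , from (witnesses⇔ ρ ρs) ¬tD) ⟩
      Σ (Subset W) (λ t → N w t × t ⊩ σ * × ¬ t ⊩ disjNeg ρ ρs)
                                                 ∼⟨ ⇔-sym (⊩w¬⇛⇔ (σ *) (disjNeg ρ ρs)) ⟩
      w ⊩w ¬' (σ * ⇛ disjNeg ρ ρs)               ∎

    all⇔* : ∀ σ {t : Subset W} → (∀ v → t v → v ⊩ᵢ σ) ⇔ t ⊩ σ *
    all⇔* σ {t} = begin
      (∀ v → t v → v ⊩ᵢ σ)    ∼⟨ mk⇔ (λ f v tv → to (⊩ᵢ⇔* σ) (f v tv))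
                                     (λ f v tv → from (⊩ᵢ⇔* σ) (f v tv)) ⟩
      (∀ v → t v → v ⊩w σ *)  ∼⟨ ⇔-sym (flat-⊩⇔ (*-flat σ)) ⟩
      t ⊩ σ *                 ∎

    has-instance⇔ : ∀ ρ {t : Subset W} → (Σ W λ v → Lift (lsuc 0ℓ) (t v) × v ⊩ᵢ ρ) ⇔ (¬ t ⊩ ¬' (ρ *))
    has-instance⇔ ρ = mk⇔
      (λ (v , lift tv , vρ) t¬ρ → to (⊩¬'⇔ (ρ *)) t¬ρ v tv (to (⊩ᵢ⇔* ρ) vρ))
      (λ ¬t¬ρ → dne λ none → ¬t¬ρ (from (⊩¬'⇔ (ρ *)) λ v tv vρ →
        none (v , lift tv , from (⊩ᵢ⇔* ρ) vρ)))

    witnesses⇔ : ∀ ρ ρs {t : Subset W} → witnesses M t (ρ ∷ ρs) ⇔ (¬ t ⊩ disjNeg ρ ρs)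
    witnesses⇔ ρ [] = mk⇔ (λ (i , _) → to (has-instance⇔ ρ) i) (λ ¬t¬ρ → from (has-instance⇔ ρ) ¬t¬ρ , _)
    witnesses⇔ ρ (ρ' ∷ ρs) {t} = begin
      witnesses M t (ρ ∷ ρ' ∷ ρs)                    ∼⟨ has-instance⇔ ρ ×-⇔ witnesses⇔ ρ' ρs ⟩
      ((¬ t ⊩ ¬' (ρ *)) × (¬ t ⊩ disjNeg ρ' ρs))    ∼⟨ mk⇔ (λ (¬l , ¬r) → ¬l ¬-⊎ ¬r)
                                                           (λ ¬l⊎r → ¬l⊎r ∘ inj₁ , ¬l⊎r ∘ inj₂) ⟩
      (¬ t ⊩ disjNeg ρ (ρ' ∷ ρs))                    ∎

proposition9p1 : ExcludedMiddle (lsuc 0ℓ) →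
    {Atom : Set} (M : NbhdModel Atom) (w : NbhdModel.W M) (σ : INL Atom) →
    _⊨ᵢ_ M w σ ⇔ _⊨w_ M w (σ *)
proposition9p1 em M w σ = TranslationCorrectness.⊩ᵢ⇔* em M σ
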